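{- Let $\Sigma$ be a finite first-order signature, $\mathcal{T}$ a $\Sigma$-theory, and $\mathcal{C}$ a class of $\Sigma$-structures. Let $\mathcal{L}_{\mathcal{C}}$ be the $\mathcal{T}$-language of all $\mathcal{T}$-words $\langle\sigma_0,\ldots,\sigma_{n-1}\rangle$ such that $\sigma_i\in\mathcal{C}$ for all $i$. If $\mathcal{C}$ is definable by an existential second-order $\Sigma$-sentence, i.e. there is a sentence $\exists P_1\ldots\exists P_n\,\psi$ with $\psi$ a first-order sentence over $\Sigma\cup\{P_1,\ldots,P_n\}$ such that a $\Sigma$-structure belongs to $\mathcal{C}$ iff it satisfies $\exists P_1\ldots\exists P_n\,\psi$, then $\mathcal{L}_{\mathcal{C}}$ is $\mathcal{T}$-regular.
   Context: Signatures are multi-sorted first-order signatures in which every symbol is marked either rigid or non-rigid. For a signature $\Sigma$, $\Sigma'$ denotes the signature obtained from $\Sigma$ by replacing each non-rigid symbol $s$ by a fresh primed copy $s'$ (rigid symbols are kept); for a $\Sigma$-structure $\sigma$, $\sigma'$ denotes the corresponding renamed $\Sigma'$-structure. For structures over pairwise disjoint signatures with the same sort domains, $\rho\cup\sigma\cup\tau'$ denotes the combined structure over the union of the signatures. A $\Sigma$-theory $\mathcal{T}$ is a set of $\Sigma$-sentences; $[\![\mathcal{T}]\!]$ is the set of all $\Sigma$-structures with finite or countably infinite domains that satisfy $\mathcal{T}$. A $\mathcal{T}$-word is a finite sequence $\bar\sigma=\langle\sigma_0,\ldots,\sigma_{n-1}\rangle$ ($n\ge 0$) of elements of $[\![\mathcal{T}]\!]$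 such that for every sort $S$ and every rigid symbol $s$ of $\Sigma$, $S^{\sigma_i}=S^{\sigma_j}$ and $s^{\sigma_i}=s^{\sigma_j}$ for all $i,j$. $[\![\mathcal{T}]\!]^*$ is the set of all $\mathcal{T}$-words; a $\mathcal{T}$-language is a subset of $[\![\mathcal{T}]\!]^*$. A first-order automaton is a tuple $\mathcal{A}=\langle\Sigma,\Gamma,\phi_0,\phi_T,\phi_F\rangle$ where $\Sigma$ (word signature) and $\Gamma$ (state signature) are finite disjoint signatures, $\phi_0$ and $\phi_F$ are first-order $\Gamma$-sentences, and $\phi_T$ is a first-order $(\Gamma\cup\Sigma\cup\Gamma')$-sentence. Given a $\mathcal{T}$-word $\bar\sigma=\langle\sigma_0,\ldots,\sigma_{n-1}\rangle$, a $\mathcal{T}$-run of $\mathcal{A}$ induced by $\bar\sigma$ is a sequence $\langle\rho_0,\ldots,\rho_n\rangle$ of $\Gamma$-structures such that $S^{\rho_i}=S^{\sigma_0}$ for every sort $S$ and every $i$, rigid symbols of $\Gamma$ are interpreted identically in all $\rho_i$, $\rho_0\models\phi_0$, and $\rho_i\cup\sigma_i\cup\rho'_{i+1}\models\phi_T$ for all $0\le i<n$. $\mathcal{A}$ $\mathcal{T}$-accepts $\bar\sigma$ iff some such run satisfies $\rho_n\models\phi_F$. $\mathcal{L}_{\mathcal{T}}(\mathcal{A})$ is the set of $\mathcal{T}$-words $\mathcal{T}$-accepted by $\mathcal{A}$. A $\mathcal{T}$-language $L$ is $\mathcal{T}$-regular iff $L=\mathcal{L}_{\mathcal{T}}(\mathcal{A})$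 for some first-order automaton $\mathcal{A}$ with word signature $\Sigma$. -}

module Defs where

open import Data.Nat using (ℕ)
open import Level using (Lift; suc; zero)
open import Data.Fin using (Fin)
open import Data.Bool using (Bool; true; false)
open import Data.List using (List; []; _∷_)
open import Data.List.Membership.Propositional using (_∈_)
open import Data.List.Relation.Unary.All as All using (All)
open import Data.Product using (Σ; Σ-syntax; _×_; _,_)
open import Data.Sum using (_⊎_; inj₁; inj₂; [_,_])
open import Data.Unit using (⊤)
open import Data.Empty using (⊥)
open import Relation.Binary.PropositionalEquality using (_≡_; refl)
open import Function.Bundles using (_↣_; _↔_)

Finite : Set → Set
Finite X = Σ[ k ∈ ℕ ] (X ↔ Fin k)

-- Multi-sorted signatures over a sort type Srt.
-- Constants are 0-ary function symbols.  Every symbol is marked rigid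
-- (true) or non-rigid (false).

record Sig (Srt : Set) : Set₁ where
  field
    Fun    : Set
    Rel    : Set
    fdom   : Fun → List Srt
    fcod   : Fun → Srt
    rdom   : Rel → List Srt
    frigid : Fun → Bool
    rrigid : Rel → Bool
open Sig public

FiniteSig : ∀ {Srt} → Sig Srt → Set
FiniteSig 𝔖 = Finite (Fun 𝔖) × Finite (Rel 𝔖)

record Interp {Srt : Set} (𝔖 : Sig Srt) (D : Srt → Set) : Set₁ where
  field
    fun : (f : Fun 𝔖) → All D (fdom 𝔖 f) → D (fcod 𝔖 f)
    rel : (r : Rel 𝔖) → All D (rdom 𝔖 r) → Set
open Interp public

record Struct {Srt : Set} (𝔖 : Sig Srt) : Set₁ where
  constructor mkStruct
  field
    Dom : Srt → Set
    int : Interp 𝔖 Dom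
open Struct public

record RigidPart {Srt : Set} (𝔖 : Sig Srt) (D : Srt → Set) : Set₁ where
  field
    rfun : (f : Fun 𝔖) → frigid 𝔖 f ≡ true → All D (fdom 𝔖 f) → D (fcod 𝔖 f)
    rrel : (r : Rel 𝔖) → rrigid 𝔖 r ≡ true → All D (rdom 𝔖 r) → Set
open RigidPart public

record NonRigidPart {Srt : Set} (𝔖 : Sig Srt) (D : Srt → Set) : Set₁ where
  field
    nfun : (f : Fun 𝔖) → frigid 𝔖 f ≡ false → All D (fdom 𝔖 f) → D (fcod 𝔖 f)
    nrel : (r : Rel 𝔖) → rrigid 𝔖 r ≡ false → All D (rdom 𝔖 r) → Set
open NonRigidPart public

select : ∀ {a} {A : Set a} (b : Bool) → (b ≡ true → A) → (b ≡ false → A) → A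
select true  t f = t refl
select false t f = f refl

combine : ∀ {Srt} {𝔖 : Sig Srt} {D : Srt → Set} →
          RigidPart 𝔖 D → NonRigidPart 𝔖 D → Interp 𝔖 D
combine {𝔖 = 𝔖} R N = record
  { fun = λ f → select (frigid 𝔖 f) (rfun R f) (nfun N f)
  ; rel = λ r → select (rrigid 𝔖 r) (rrel R r) (nrel N r) }

module _ {Srt : Set} (𝔖 : Sig Srt) where

  mutual
    data Term (Γ : List Srt) : Srt → Set where
      var : ∀ {s} → s ∈ Γ → Term Γ s
      app : (f : Fun 𝔖) → Terms Γ (fdom 𝔖 f) → Term Γ (fcod 𝔖 f)

    data Terms (Γ : List Srt) : List Srt → Set where
      []  : Terms Γ []
      _∷_ : ∀ {s ss} → Term Γ s → Terms Γ ss → Terms Γ (s ∷ ss)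

  data Formula (Γ : List Srt) : Set where
    ⊤ᶠ ⊥ᶠ : Formula Γ
    _≐_   : ∀ {s} → Term Γ s → Term Γ s → Formula Γ
    relᶠ  : (r : Rel 𝔖) → Terms Γ (rdom 𝔖 r) → Formula Γ
    ¬ᶠ_   : Formula Γ → Formula Γ
    _∧ᶠ_ _∨ᶠ_ _⇒ᶠ_ : Formula Γ → Formula Γ → Formula Γ
    ∀ᶠ ∃ᶠ : (s : Srt) → Formula (s ∷ Γ) → Formula Γ

  Sentence : Set
  Sentence = Formula []

module _ {Srt : Set} {𝔖 : Sig Srt} {D : Srt → Set} (I : Interp 𝔖 D) where

  mutual
    evalT : ∀ {Γ s} → Term 𝔖 Γ s → All D Γ → D s
    evalT (var x)    ρ = All.lookup ρ x
    evalT (app f ts) ρ = fun I f (evalTs ts ρ)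

    evalTs : ∀ {Γ ss} → Terms 𝔖 Γ ss → All D Γ → All D ss
    evalTs []       ρ = All.[]
    evalTs (t ∷ ts) ρ = evalT t ρ All.∷ evalTs ts ρ

  sat : ∀ {Γ} → Formula 𝔖 Γ → All D Γ → Set
  sat ⊤ᶠ         ρ = ⊤
  sat ⊥ᶠ         ρ = ⊥
  sat (t ≐ u)    ρ = evalT t ρ ≡ evalT u ρ
  sat (relᶠ r ts) ρ = rel I r (evalTs ts ρ)
  sat (¬ᶠ φ)     ρ = sat φ ρ → ⊥
  sat (φ ∧ᶠ ψ)   ρ = sat φ ρ × sat ψ ρ
  sat (φ ∨ᶠ ψ)   ρ = sat φ ρ ⊎ sat ψ ρ
  sat (φ ⇒ᶠ ψ)   ρ = sat φ ρ → sat ψ ρ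
  sat (∀ᶠ s φ)   ρ = (d : D s) → sat φ (d All.∷ ρ)
  sat (∃ᶠ s φ)   ρ = Σ[ d ∈ D s ] sat φ (d All.∷ ρ)

  _⊨_ : Sentence 𝔖 → Set
  _⊨_ φ = sat φ All.[]

_⊨ᵀ_ : ∀ {Srt} {𝔖 : Sig Srt} {D : Srt → Set} →
       Interp 𝔖 D → (Sentence 𝔖 → Set) → Set
I ⊨ᵀ T = ∀ φ → T φ → _⊨_ I φ

Theory : ∀ {Srt} → Sig Srt → Set₁
Theory 𝔖 = Sentence 𝔖 → Set

record Word {Srt : Set} (𝔖 : Sig Srt) (T : Theory 𝔖) : Set₁ where
  field
    D         : Srt → Set
    countable : (s : Srt) → D s ↣ ℕ
    nonempty  : (s : Srt) → D s
    rigid     : RigidPart 𝔖 D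
    letters   : List (NonRigidPart 𝔖 D)
    models    : All (λ ν → combine rigid ν ⊨ᵀ T) letters
open Word public

Language : ∀ {Srt} (𝔖 : Sig Srt) → Theory 𝔖 → Set₂
Language 𝔖 T = Word 𝔖 T → Set₁

-- Γ ∪ Σ ∪ Γ'  (primed copies only of the non-rigid symbols of Γ)
Three : ∀ {Srt} → Sig Srt → Sig Srt → Sig Srt
Three Γ 𝔖 = record
  { Fun    = Fun Γ ⊎ (Fun 𝔖 ⊎ Σ[ f ∈ Fun Γ ] frigid Γ f ≡ false)
  ; Rel    = Rel Γ ⊎ (Rel 𝔖 ⊎ Σ[ r ∈ Rel Γ ] rrigid Γ r ≡ false)
  ; fdom   = [ fdom Γ , [ fdom 𝔖 , (λ p → fdom Γ (Data.Product.proj₁ p)) ] ]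
  ; fcod   = [ fcod Γ , [ fcod 𝔖 , (λ p → fcod Γ (Data.Product.proj₁ p)) ] ]
  ; rdom   = [ rdom Γ , [ rdom 𝔖 , (λ p → rdom Γ (Data.Product.proj₁ p)) ] ]
  ; frigid = [ frigid Γ , [ frigid 𝔖 , (λ _ → false) ] ]
  ; rrigid = [ rrigid Γ , [ rrigid 𝔖 , (λ _ → false) ] ]
  }
  where import Data.Product

-- the combined structure ρ ∪ σ ∪ τ' (ρ, τ share the rigid Γ-part R)
union3 : ∀ {Srt} {Γ 𝔖 : Sig Srt} {D : Srt → Set} →
         RigidPart Γ D → NonRigidPart Γ D →
         RigidPart 𝔖 D → NonRigidPart 𝔖 D →
         NonRigidPart Γ D → Interp (Three Γ 𝔖) D
union3 R ρ S σ τ = record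
  { fun = [ fun (combine R ρ) , [ fun (combine S σ) , (λ { (f , p) → nfun τ f p }) ] ]
  ; rel = [ rel (combine R ρ) , [ rel (combine S σ) , (λ { (r , p) → nrel τ r p }) ] ]
  }

_+R_ : ∀ {Srt} {n : ℕ} → Sig Srt → (Fin n → List Srt) → Sig Srt
_+R_ {n = n} 𝔖 ar = record
  { Fun = Fun 𝔖 ; Rel = Rel 𝔖 ⊎ Fin n
  ; fdom = fdom 𝔖 ; fcod = fcod 𝔖 ; rdom = [ rdom 𝔖 , ar ]
  ; frigid = frigid 𝔖 ; rrigid = [ rrigid 𝔖 , (λ _ → true) ] }

expand : ∀ {Srt} {n} {𝔖 : Sig Srt} {ar : Fin n → List Srt} (M : Struct 𝔖) →
         ((i : Fin n) → All (Dom M) (ar i) → Set) → Interp (𝔖 +R ar) (Dom M)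
expand M P = record { fun = fun (int M) ; rel = [ rel (int M) , P ] }

ESOWitness : ∀ {Srt} {𝔖 : Sig Srt} {n : ℕ} {ar : Fin n → List Srt} →
             Sentence (𝔖 +R ar) → Struct 𝔖 → Set₁
ESOWitness {n = n} {ar} ψ M =
  Σ[ P ∈ ((i : Fin n) → All (Dom M) (ar i) → Set) ] (expand M P ⊨ ψ)

ESODefinable : ∀ {Srt} (𝔖 : Sig Srt) → (Struct 𝔖 → Set₁) → Set₁
ESODefinable {Srt} 𝔖 C =
  Σ[ n ∈ ℕ ] Σ[ ar ∈ (Fin n → List Srt) ] Σ[ ψ ∈ Sentence (𝔖 +R ar) ]
    ((M : Struct 𝔖) → (C M → ESOWitness ψ M) × (ESOWitness ψ M → C M))

LC : ∀ {Srt} (𝔖 : Sig Srt) (T : Theory 𝔖) → (Struct 𝔖 → Set₁) → Language 𝔖 T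
LC 𝔖 T C w = All (λ ν → C (mkStruct (D w) (combine (rigid w) ν))) (letters w)

record FOA {Srt : Set} (𝔖 : Sig Srt) : Set₁ where
  field
    Γ       : Sig Srt
    Γfinite : FiniteSig Γ
    φ₀      : Sentence Γ
    φT      : Sentence (Three Γ 𝔖)
    φF      : Sentence Γ
open FOA public

module _ {Srt : Set} {𝔖 : Sig Srt} (A : FOA 𝔖) {D : Srt → Set}
         (R : RigidPart (Γ A) D) (S : RigidPart 𝔖 D) where

  RunFrom : NonRigidPart (Γ A) D → List (NonRigidPart 𝔖 D) → Set₁
  RunFrom ρ []       = Lift (suc zero) (combine R ρ ⊨ φF A)
  RunFrom ρ (σ ∷ σs) = Σ[ ρ′ ∈ NonRigidPart (Γ A) D ]
                        (union3 R ρ S σ ρ′ ⊨ φT A) × RunFrom ρ′ σs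

Accepts : ∀ {Srt} {𝔖 : Sig Srt} {T : Theory 𝔖} → FOA 𝔖 → Word 𝔖 T → Set₁
Accepts {𝔖 = 𝔖} A w =
  Σ[ R ∈ RigidPart (Γ A) (D w) ] Σ[ ρ₀ ∈ NonRigidPart (Γ A) (D w) ]
    (combine R ρ₀ ⊨ φ₀ A) × RunFrom A R (rigid w) ρ₀ (letters w)

Regular : ∀ {Srt} (𝔖 : Sig Srt) (T : Theory 𝔖) → Language 𝔖 T → Set₁
Regular 𝔖 T L =
  Σ[ A ∈ FOA 𝔖 ] ((w : Word 𝔖 T) → (L w → Accepts A w) × (Accepts A w → L w))

{-# OPTIONS --safe #-}
module Submission where

-- The automaton guesses the second-order witnesses letter by letter: its
-- states interpret the predicates P₁ … Pₙ, and the transition on a letter σ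
-- is ψ read with Σ-symbols interpreted by σ and each Pᵢ by the current
-- state.  So a run is exactly a choice of witnesses for ∃P̄ ψ in every
-- letter, the state before each letter holding its witnesses; the initial
-- and final conditions are ⊤.

open import Defs
open import Data.Nat using (ℕ)
open import Data.Fin using (Fin)
open import Data.Bool using (false)
open import Data.List using (List; []; _∷_)
open import Data.List.Relation.Unary.All as All using (All)
open import Data.Product using (Σ-syntax; _,_; proj₁; proj₂)
open import Data.Product.Function.NonDependent.Propositional using (_×-⇔_)
import Data.Product.Function.Dependent.Propositional as Σ
open import Data.Sum using (inj₁; inj₂)
open import Data.Sum.Function.Propositional using (_⊎-⇔_)
open import Data.Unit using (tt)
open import Data.Empty using (⊥)
open import Function using (_∘_)
open import Function.Bundles using (_⇔_; mk⇔; mk↔ₛ′; Equivalence)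
open import Function.Construct.Identity using (⇔-id)
open import Function.Properties.Inverse using (↔-refl)
open import Function.Related.TypeIsomorphisms using (→-cong-⇔; ¬-cong-⇔)
open import Level using (lift)
open import Relation.Binary.PropositionalEquality using (_≡_; refl; cong₂)

open Equivalence using (to; from)

-- Symbols indexed by their arity, so that a renaming preserves arities
-- definitionally and terms can be renamed without transport.
data FunSymbol {Srt : Set} (𝔖 : Sig Srt) : List Srt → Srt → Set where
  ⌜_⌝ : (f : Fun 𝔖) → FunSymbol 𝔖 (fdom 𝔖 f) (fcod 𝔖 f)

data RelSymbol {Srt : Set} (𝔖 : Sig Srt) : List Srt → Set where
  ⌜_⌝ : (r : Rel 𝔖) → RelSymbol 𝔖 (rdom 𝔖 r)

record Renaming {Srt : Set} (E F : Sig Srt) : Set where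
  field
    renFun : (f : Fun E) → FunSymbol F (fdom E f) (fcod E f)
    renRel : (r : Rel E) → RelSymbol F (rdom E r)
open Renaming

module _ {Srt : Set} {F : Sig Srt} where

  appSym : ∀ {Γ ss s} → FunSymbol F ss s → Terms F Γ ss → Term F Γ s
  appSym ⌜ f ⌝ = app f

  relSym : ∀ {Γ ss} → RelSymbol F ss → Terms F Γ ss → Formula F Γ
  relSym ⌜ r ⌝ = relᶠ r

  module _ {D : Srt → Set} (J : Interp F D) where

    funOf : ∀ {ss s} → FunSymbol F ss s → All D ss → D s
    funOf ⌜ f ⌝ = fun J f

    relOf : ∀ {ss} → RelSymbol F ss → All D ss → Set
    relOf ⌜ r ⌝ = rel J r

    evalT-appSym : ∀ {Γ ss s} (g : FunSymbol F ss s) (ts : Terms F Γ ss) ρ →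
                   evalT J (appSym g ts) ρ ≡ funOf g (evalTs J ts ρ)
    evalT-appSym ⌜ f ⌝ ts ρ = refl

    sat-relSym : ∀ {Γ ss} (r : RelSymbol F ss) (ts : Terms F Γ ss) ρ →
                 sat J (relSym r ts) ρ ≡ relOf r (evalTs J ts ρ)
    sat-relSym ⌜ r ⌝ ts ρ = refl

module _ {Srt : Set} {E F : Sig Srt} (h : Renaming E F) where

  mutual
    renameT : ∀ {Γ s} → Term E Γ s → Term F Γ s
    renameT (var x)    = var x
    renameT (app f ts) = appSym (renFun h f) (renameTs ts)

    renameTs : ∀ {Γ ss} → Terms E Γ ss → Terms F Γ ss
    renameTs []       = []
    renameTs (t ∷ ts) = renameT t ∷ renameTs ts

  rename : ∀ {Γ} → Formula E Γ → Formula F Γ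
  rename ⊤ᶠ          = ⊤ᶠ
  rename ⊥ᶠ          = ⊥ᶠ
  rename (t ≐ u)     = renameT t ≐ renameT u
  rename (relᶠ r ts) = relSym (renRel h r) (renameTs ts)
  rename (¬ᶠ φ)      = ¬ᶠ rename φ
  rename (φ ∧ᶠ ψ)    = rename φ ∧ᶠ rename ψ
  rename (φ ∨ᶠ ψ)    = rename φ ∨ᶠ rename ψ
  rename (φ ⇒ᶠ ψ)    = rename φ ⇒ᶠ rename ψ
  rename (∀ᶠ s φ)    = ∀ᶠ s (rename φ)
  rename (∃ᶠ s φ)    = ∃ᶠ s (rename φ)

  module _ {D : Srt → Set} {I : Interp E D} {J : Interp F D}
           (fun-agrees : ∀ f xs → funOf J (renFun h f) xs ≡ fun I f xs)
           (rel-agrees : ∀ r xs → relOf J (renRel h r) xs ⇔ rel I r xs) where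

    mutual
      evalT-rename : ∀ {Γ s} (t : Term E Γ s) ρ → evalT J (renameT t) ρ ≡ evalT I t ρ
      evalT-rename (var x)    ρ = refl
      evalT-rename (app f ts) ρ rewrite evalT-appSym J (renFun h f) (renameTs ts) ρ
                                      | evalTs-rename ts ρ = fun-agrees f _

      evalTs-rename : ∀ {Γ ss} (ts : Terms E Γ ss) ρ → evalTs J (renameTs ts) ρ ≡ evalTs I ts ρ
      evalTs-rename []       ρ = refl
      evalTs-rename (t ∷ ts) ρ = cong₂ All._∷_ (evalT-rename t ρ) (evalTs-rename ts ρ)

    sat-rename : ∀ {Γ} (φ : Formula E Γ) ρ → sat J (rename φ) ρ ⇔ sat I φ ρ
    sat-rename ⊤ᶠ          ρ = ⇔-id _
    sat-rename ⊥ᶠ          ρ = ⇔-id _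
    sat-rename (t ≐ u)     ρ rewrite evalT-rename t ρ | evalT-rename u ρ = ⇔-id _
    sat-rename (relᶠ r ts) ρ rewrite sat-relSym J (renRel h r) (renameTs ts) ρ
                                   | evalTs-rename ts ρ = rel-agrees r _
    sat-rename (¬ᶠ φ)      ρ = ¬-cong-⇔ (sat-rename φ ρ)
    sat-rename (φ ∧ᶠ ψ)    ρ = sat-rename φ ρ ×-⇔ sat-rename ψ ρ
    sat-rename (φ ∨ᶠ ψ)    ρ = sat-rename φ ρ ⊎-⇔ sat-rename ψ ρ
    sat-rename (φ ⇒ᶠ ψ)    ρ = →-cong-⇔ (sat-rename φ ρ) (sat-rename ψ ρ)
    sat-rename (∀ᶠ s φ)    ρ = mk⇔ (λ all d → to (sat-rename φ _) (all d))
                                   (λ all d → from (sat-rename φ _) (all d))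
    sat-rename (∃ᶠ s φ)    ρ = Σ.congˡ (sat-rename φ _)

module ESOAutomaton {Srt : Set} (𝔖 : Sig Srt) {n : ℕ} (ar : Fin n → List Srt) where

  Predicates : Sig Srt
  Predicates = record { Fun = ⊥ ; Rel = Fin n ; fdom = λ () ; fcod = λ () ; rdom = ar
                      ; frigid = λ () ; rrigid = λ _ → false }

  predicates-finite : FiniteSig Predicates
  predicates-finite = (0 , mk↔ₛ′ (λ ()) (λ ()) (λ ()) (λ ())) , (n , ↔-refl)

  predicatesAsState : Renaming (𝔖 +R ar) (Three Predicates 𝔖)
  predicatesAsState = record
    { renFun = λ f → ⌜ inj₂ (inj₁ f) ⌝
    ; renRel = λ { (inj₁ r) → ⌜ inj₂ (inj₁ r) ⌝ ; (inj₂ i) → ⌜ inj₁ i ⌝ } }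

  esoAutomaton : Sentence (𝔖 +R ar) → FOA 𝔖
  esoAutomaton ψ = record
    { Γ = Predicates ; Γfinite = predicates-finite
    ; φ₀ = ⊤ᶠ ; φT = rename predicatesAsState ψ ; φF = ⊤ᶠ }

  module _ {D : Srt → Set} where

    Valuation : Set₁
    Valuation = (i : Fin n) → All D (ar i) → Set

    stateOf : Valuation → NonRigidPart Predicates D
    stateOf P = record { nfun = λ () ; nrel = λ i _ → P i }

    valuationOf : NonRigidPart Predicates D → Valuation
    valuationOf ρ i = nrel ρ i refl

    noRigid : RigidPart Predicates D
    noRigid = record { rfun = λ () ; rrel = λ _ () }

    module _ (ψ : Sentence (𝔖 +R ar)) (S : RigidPart 𝔖 D) where

      Witnessed : NonRigidPart 𝔖 D → Set₁
      Witnessed σ = ESOWitness ψ (mkStruct D (combine S σ))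

      module _ (R : RigidPart Predicates D) where

        transition⇔witness : ∀ ρ σ ρ′ →
          union3 R ρ S σ ρ′ ⊨ φT (esoAutomaton ψ) ⇔
          expand (mkStruct D (combine S σ)) (valuationOf ρ) ⊨ ψ
        transition⇔witness ρ σ ρ′ =
          sat-rename predicatesAsState (λ _ _ → refl)
            (λ { (inj₁ r) _ → ⇔-id _ ; (inj₂ i) _ → ⇔-id _ }) ψ All.[]

        run⇒witnessed : ∀ ρ σs → RunFrom (esoAutomaton ψ) R S ρ σs → All Witnessed σs
        run⇒witnessed ρ []       _                = All.[]
        run⇒witnessed ρ (σ ∷ σs) (ρ′ , step , run) =
          (valuationOf ρ , to (transition⇔witness ρ σ ρ′) step) All.∷ run⇒witnessed ρ′ σs run

        witnessed⇒run : ∀ {σs} → All Witnessed σs →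
                        Σ[ ρ ∈ NonRigidPart Predicates D ] RunFrom (esoAutomaton ψ) R S ρ σs
        witnessed⇒run All.[]                = stateOf (λ _ _ → ⊥) , lift tt
        witnessed⇒run {σ ∷ _} ((P , ⊨ψ) All.∷ ws) =
          let ρ′ , run = witnessed⇒run ws
          in  stateOf P , ρ′ , from (transition⇔witness (stateOf P) σ ρ′) ⊨ψ , run

  accepts⇔witnessed : ∀ {T} ψ (w : Word 𝔖 T) →
    Accepts (esoAutomaton ψ) w ⇔ All (Witnessed ψ (rigid w)) (letters w)
  accepts⇔witnessed ψ w = mk⇔
    (λ { (R , ρ₀ , _ , run) → run⇒witnessed ψ (rigid w) R ρ₀ (letters w) run })
    (λ ws → let ρ₀ , run = witnessed⇒run ψ (rigid w) noRigid ws in noRigid , ρ₀ , tt , run)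

theorem3 : {Srt : Set} (𝔖 : Sig Srt) → Finite Srt → FiniteSig 𝔖 →
    (T : Theory 𝔖) (C : Struct 𝔖 → Set₁) →
    ESODefinable 𝔖 C → Regular 𝔖 T (LC 𝔖 T C)
theorem3 𝔖 _ _ _ _ (_ , ar , ψ , defines) = esoAutomaton ψ , λ w →
    from (accepts⇔witnessed ψ w) ∘ All.map (proj₁ (defines _))
  , All.map (proj₂ (defines _)) ∘ to (accepts⇔witnessed ψ w)
  where open ESOAutomaton 𝔖 ar
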